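{- Assume additionally that $\deg M_{i,1}\equiv\deg M_{i,2}\equiv\deg M_{i,3}\bmod 2$ for every $i\in[m]$. Let $f_1,\dots,f_n\subseteq[n]\cup\{ -\}$ satisfy $f_j\in W_{\{j\}}$, $j\notin f_j$ and $|\{i\}\cap f_j| = |\{j\}\cap f_i|$ for all $i,j\in[n]$, and let $J\subseteq\{i\in[n] : \{ -\}\in V_{\{i\}}\}$. Assume that \[ |J| \not\equiv \sum_{i\in[n]}|\{ -\}\cap f_i| + \sum_{\{i,j\}\subseteq[n]}|\{j\}\cap f_i| \bmod 2. \] Then \[ \sum_{\mathbf{s}\ \text{admissible}} \operatorname{Tw}(f,\mathbf{s})\prod_{i\in J}\left(\frac{ -1}{s_i}\right) = 0. \]
   Context: Setting: integers $n \geq 2$, $m \geq 1$ and squarefree monomials $M_{i,j}(t_1,\dots,t_n)$ ($i \in [m]$, $j \in \{1,2,3\}$, $[n]=\{1,\dots,n\}$) with leading coefficient $\pm1$, with $M_{i,1},M_{i,2},M_{i,3}$ pairwise coprime for each $i$. View $\mathcal{P}([n]\cup\{ -\})$ ($-$ a formal symbol) as an $\mathbb{F}_2$-vector space under symmetric difference $+$. Encode a monomial $\pm\prod_{l\in S'}t_l$ as $S'$ (sign $+$) or $S'\cup\{ -\}$ (sign $-$); let $S_{i,k}$ encode $M_{i,k}$. For $j\in[n]$ put $g_{i,\{j\}} = \varnothing$ if $j\notin S_{i,1}\cup S_{i,2}\cup S_{i,3}$, and $g_{i,\{j\}} = \{ -\}+S_{i,k'}+S_{i,k''}$ if $j \in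 S_{i,k}$ where $\{k,k',k''\}=\{1,2,3\}$. Let $V_{\{j\}}$ be the span of $\{g_{i,\{j\}}: i\in[m]\}$; let $W_{\{j\}} = V_{\{j\}}$ if $\{ -\}\notin V_{\{j\}}$ and $W_{\{j\}} = \{T\in V_{\{j\}} : -\notin T\}$ otherwise. A vector $\mathbf{s}\in\{\pm1\}^n$ is admissible if for every $i\in[m]$ the conic $M_{i,1}(\mathbf{s})x^2+M_{i,2}(\mathbf{s})y^2+M_{i,3}(\mathbf{s})z^2=0$ has a non-trivial real solution. For $\mathbf{a}\in(\mathbb{Q}^\times)^n$, $\operatorname{Tw}(f,\mathbf{a}) = \prod_{i\in[n]}(-1,a_i)_2^{|\{ -\}\cap f_i|}\prod_{\{i,j\}\subseteq[n]}(a_i,a_j)_2^{|\{j\}\cap f_i|}$, where $(\cdot,\cdot)_2$ is the $2$-adic Hilbert symbol and $\{i,j\}$ ranges over unordered pairs of distinct elements. For $s\in\{\pm1\}$, $\left(\frac{ -1}{s}\right)$ is the Kronecker symbol, i.e. $\left(\frac{ -1}{1}\right)=1$, $\left(\frac{ -1}{ -1}\right)=-1$. -}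

module Defs where

open import Data.Bool using (Bool; true; false; if_then_else_; _∧_; _∨_; not; _xor_)
open import Data.Nat as ℕ using (ℕ; zero; suc; _≡ᵇ_)
open import Data.Nat.DivMod using (_/_; _%_)
open import Data.Fin using (Fin; toℕ)
open import Data.Fin.Subset using (Subset)
open import Data.List as List using (List; []; _∷_; map; concatMap; allFin; foldr; filter)
open import Data.Vec as Vec using (Vec; lookup; replicate; zipWith)
open import Data.Sign as Sign using (Sign)
open import Data.Integer as ℤ using (ℤ; +_; -_; ∣_∣; sign)
open import Data.Rational as ℚ using (ℚ; ↥_; ↧_; 1ℚ; -_)
open import Data.Product using (Σ; _×_; _,_; proj₁; proj₂)
open import Data.Empty using (⊥)
open import Relation.Binary.PropositionalEquality using (_≡_)

-- Subsets of [n] ∪ {-} are encoded as  Subset (suc n) = Vec Bool (suc n):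
-- position  zero  is the formal symbol  "-",  position  suc j  is  j ∈ [n]
-- (where [n] is represented by Fin n).

PSet : ℕ → Set
PSet n = Subset (suc n)

_∈ᵇ_ : ∀ {k} → Fin k → Subset k → Bool
x ∈ᵇ S = lookup S x

minusIdx : ∀ {n} → Fin (suc n)
minusIdx = Fin.zero

elt : ∀ {n} → Fin n → Fin (suc n)
elt j = Fin.suc j

_+ₛ_ : ∀ {n} → PSet n → PSet n → PSet n
_+ₛ_ = zipWith _xor_

∅ₛ : ∀ {n} → PSet n
∅ₛ = replicate _ false

minusSet : ∀ {n} → PSet n
minusSet {n} = true Vec.∷ replicate n false

linComb : ∀ {n m} → (Fin m → Bool) → (Fin m → PSet n) → PSet n
linComb {m = m} c g =
  foldr (λ i acc → if c i then g i +ₛ acc else acc) ∅ₛ (allFin m)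

InSpan : ∀ {n m} → (Fin m → PSet n) → PSet n → Set
InSpan {m = m} g T = Σ (Fin m → Bool) (λ c → linComb c g ≡ T)

deg : ∀ {n} → PSet n → ℕ
deg {n} S = foldr (λ l acc → if elt l ∈ᵇ S then suc acc else acc) 0 (allFin n)

-- two encoded monomials share no variable (for squarefree monomials with
-- leading coefficient ±1 this is coprimality)
Coprime : ∀ {n} → PSet n → PSet n → Set
Coprime {n} A B = (l : Fin n) → elt l ∈ᵇ A ≡ true → elt l ∈ᵇ B ≡ true → ⊥

-- The vectors g_{i,{j}}, the spaces V_{{j}}, and membership in W_{{j}}.
-- The monomials are given as three families S₁ S₂ S₃ : Fin m → PSet n,
-- S_k i being the encoding S_{i,k} of M_{i,k}.

gvec : ∀ {n m} → (S₁ S₂ S₃ : Fin m → PSet n) → Fin m → Fin n → PSet n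
gvec S₁ S₂ S₃ i j =
  if elt j ∈ᵇ S₁ i then minusSet +ₛ (S₂ i +ₛ S₃ i)
  else if elt j ∈ᵇ S₂ i then minusSet +ₛ (S₁ i +ₛ S₃ i)
  else if elt j ∈ᵇ S₃ i then minusSet +ₛ (S₁ i +ₛ S₂ i)
  else ∅ₛ

InV : ∀ {n m} → (S₁ S₂ S₃ : Fin m → PSet n) → Fin n → PSet n → Set
InV S₁ S₂ S₃ j T = InSpan (λ i → gvec S₁ S₂ S₃ i j) T

InW : ∀ {n m} → (S₁ S₂ S₃ : Fin m → PSet n) → Fin n → PSet n → Set
InW S₁ S₂ S₃ j T =
  InV S₁ S₂ S₃ j T × (InV S₁ S₂ S₃ j minusSet → minusIdx ∈ᵇ T ≡ false)

allSigns : (n : ℕ) → List (Vec Sign n)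
allSigns zero = Vec.[] ∷ []
allSigns (suc n) =
  concatMap (λ v → (Sign.+ Vec.∷ v) ∷ (Sign.- Vec.∷ v) ∷ []) (allSigns n)

evalMono : ∀ {n} → PSet n → Vec Sign n → Sign
evalMono {n} S s =
  foldr (λ l acc → (if elt l ∈ᵇ S then lookup s l else Sign.+) Sign.* acc)
        (if minusIdx ∈ᵇ S then Sign.- else Sign.+) (allFin n)

-- For nonzero real coefficients a,b,c, the conic a x² + b y² + c z² = 0 has a
-- non-trivial real solution iff a, b, c do not all have the same sign.
-- (ℝ is not available; this is the real-solvability criterion.)
conicRealSolvable : Sign → Sign → Sign → Bool
conicRealSolvable Sign.+ Sign.+ Sign.+ = false
conicRealSolvable Sign.- Sign.- Sign.- = false
conicRealSolvable _ _ _ = true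

admissible : ∀ {n m} → (S₁ S₂ S₃ : Fin m → PSet n) → Vec Sign n → Bool
admissible {m = m} S₁ S₂ S₃ s =
  foldr (λ i acc → conicRealSolvable (evalMono (S₁ i) s) (evalMono (S₂ i) s)
                                     (evalMono (S₃ i) s) ∧ acc)
        true (allFin m)

val2 : ℕ → ℕ → ℕ × ℕ
val2 zero k = 0 , k
val2 (suc fuel) k with ((k % 2) ≡ᵇ 0) ∧ not (k ≡ᵇ 0)
... | true  = let r = val2 fuel (k / 2) in suc (proj₁ r) , proj₂ r
... | false = 0 , k

decomp2 : ℤ → ℕ × ℕ
decomp2 a with val2 ∣ a ∣ ∣ a ∣
... | α , u with sign a
...   | Sign.+ = α , u % 8
...   | Sign.- = α , (8 ℕ.∸ (u % 8)) % 8

-- ε(u) = (u-1)/2 mod 2,  ω(u) = (u²-1)/8 mod 2, from u mod 8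
ε8 : ℕ → Bool
ε8 r = (r ≡ᵇ 3) ∨ (r ≡ᵇ 7)

ω8 : ℕ → Bool
ω8 r = (r ≡ᵇ 3) ∨ (r ≡ᵇ 5)

oddᵇ : ℕ → Bool
oddᵇ k = (k % 2) ≡ᵇ 1

-- (a,b)_2 = (-1)^{ε(u)ε(v) + α ω(v) + β ω(u)}  for a = 2^α u, b = 2^β v
hilbert2ℤ : ℤ → ℤ → ℤ
hilbert2ℤ a b with decomp2 a | decomp2 b
... | α , u | β , v =
  if (ε8 u ∧ ε8 v) xor (oddᵇ α ∧ ω8 v) xor (oddᵇ β ∧ ω8 u)
  then ℤ.-[1+ 0 ] else + 1

-- on ℚ^× : (p/q, r/t)_2 = (pq, rt)_2 since q² and t² are squares
hilbert2 : ℚ → ℚ → ℤ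
hilbert2 a b = hilbert2ℤ ((↥ a) ℤ.* (↧ a)) ((↥ b) ℤ.* (↧ b))

prodℤ : ∀ {A : Set} → (A → ℤ) → List A → ℤ
prodℤ h = foldr (λ x acc → h x ℤ.* acc) (+ 1)

sumℤ : ∀ {A : Set} → (A → ℤ) → List A → ℤ
sumℤ h = foldr (λ x acc → h x ℤ.+ acc) (+ 0)

sumℕ : ∀ {A : Set} → (A → ℕ) → List A → ℕ
sumℕ h = foldr (λ x acc → h x ℕ.+ acc) 0

pairs : (n : ℕ) → List (Fin n × Fin n)
pairs n = concatMap (λ i → concatMap (λ j → if (toℕ i ℕ.<ᵇ toℕ j) then (i , j) ∷ [] else [])
                                      (allFin n)) (allFin n)

-1ℚ : ℚ
-1ℚ = ℚ.- 1ℚ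

Tw : ∀ {n} → (f : Fin n → PSet n) → (a : Fin n → ℚ) → ℤ
Tw {n} f a =
  prodℤ (λ i → if minusIdx ∈ᵇ f i then hilbert2 -1ℚ (a i) else + 1) (allFin n)
  ℤ.* prodℤ (λ p → if elt (proj₂ p) ∈ᵇ f (proj₁ p) then hilbert2 (a (proj₁ p)) (a (proj₂ p)) else + 1)
            (pairs n)

signℚ : Sign → ℚ
signℚ Sign.+ = 1ℚ
signℚ Sign.- = -1ℚ

kron-1 : Sign → ℤ
kron-1 Sign.+ = + 1
kron-1 Sign.- = ℤ.-[1+ 0 ]

twistedSum : ∀ {n m} → (S₁ S₂ S₃ : Fin m → PSet n) → (f : Fin n → PSet n) → Subset n → ℤ
twistedSum {n} S₁ S₂ S₃ f J =
  sumℤ (λ s → if admissible S₁ S₂ S₃ s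
              then Tw f (λ i → signℚ (lookup s i))
                   ℤ.* prodℤ (λ i → if i ∈ᵇ J then kron-1 (lookup s i) else + 1) (allFin n)
              else + 0)
       (allSigns n)

twExponent : ∀ {n} → (f : Fin n → PSet n) → ℕ
twExponent {n} f =
  sumℕ (λ i → if minusIdx ∈ᵇ f i then 1 else 0) (allFin n)
  ℕ.+ sumℕ (λ p → if elt (proj₂ p) ∈ᵇ f (proj₁ p) then 1 else 0) (pairs n)

-- Negating every sign, s ↦ -s, permutes the admissible vectors: the three monomials of each
-- conic have degrees of equal parity, so they all change sign or all keep it. Writing
-- u_i = [s_i < 0], we have (-1, s_i)_2 = (-1)^u_i and (s_i, s_j)_2 = (-1)^(u_i u_j), so the
-- summand equals (-1)^E(u) for the F₂-quadratic form
--   E(u) = Σ_i [- ∈ f_i] u_i + Σ_{i<j} [j ∈ f_i] u_i u_j + Σ_{i ∈ J} u_i .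
-- Complementing u changes E by the constant Σ|{-} ∩ f_i| + Σ|{j} ∩ f_i| + |J|, which is odd,
-- plus the cross term Σ_{i<j} [j ∈ f_i] (u_i + u_j) = Σ_i u_i deg f_i; the latter vanishes
-- because f is symmetric with empty diagonal and every element of V_{j} has even degree.
-- Hence the summand is odd under the negation and the sum is zero.
module Submission where

open import Defs
open import Data.Bool using (Bool; true; false)
open import Data.Nat using (ℕ; _≤_; _%_)
open import Data.Fin using (Fin)
open import Data.Fin.Subset using (Subset; ∣_∣)
open import Data.Integer using (ℤ; +_)
open import Data.Product using (_×_)
open import Relation.Binary.PropositionalEquality using (_≡_; _≢_)

open import Algebra using (CommutativeRing)
open import Data.Bool using (_∧_; _xor_; not; if_then_else_)
open import Data.Bool.Properties
  using (xor-∧-commutativeRing; xor-assoc; xor-identityʳ; xor-comm; xor-same; true-xor; not-distribˡ-xor;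
         not-involutive; ∧-zeroʳ; ∧-distribˡ-xor; ∧-distribʳ-xor; ∧-comm)
open import Data.Bool.Solver using (module xor-∧-Solver)
open import Data.Fin using (zero; suc; toℕ)
open import Data.Integer as ℤ using (0ℤ; 1ℤ; -1ℤ; -_; _*_)
  renaming (_+_ to _+ℤ_)
open import Data.Integer.Properties using (neg-distrib-+; +-assoc; +-comm)
open import Data.List using (List; []; _∷_; _++_; concatMap; allFin; tabulate; foldr)
open import Data.List.Properties using (foldr-cong; foldr-fusion)
open import Data.Nat using (zero; suc; _<ᵇ_) renaming (_+_ to _+ℕ_)
open import Data.Nat.DivMod using ([m+n]%n≡m%n)
import Data.Nat.Properties as ℕ
open import Data.Product using (_,_; proj₁; proj₂)
open import Data.Sign as Sign using (Sign; opposite)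
open import Data.Sign.Properties using (opposite-involutive)
open import Data.Vec as Vec using (Vec; lookup; replicate)
open import Data.Vec.Properties using (lookup-map; lookup-zipWith; lookup-replicate)
open import Algebra.Properties.CommutativeSemigroup
  (CommutativeRing.+-commutativeSemigroup xor-∧-commutativeRing)
  using () renaming (interchange to xor-interchange)
open import Relation.Binary.PropositionalEquality using (refl; sym; trans; cong; cong₂; module ≡-Reasoning)
open import Relation.Nullary using (contradiction)
open ≡-Reasoning

private
  variable
    A B : Set
    n : ℕ

-- Sums over F₂

xorSum : (A → Bool) → List A → Bool
xorSum F = foldr (λ x acc → F x xor acc) false

xorSum-cong : {F G : A → Bool} → (∀ x → F x ≡ G x) → ∀ xs → xorSum F xs ≡ xorSum G xs
xorSum-cong F≗G = foldr-cong (λ x acc → cong (_xor acc) (F≗G x)) refl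

xorSum-false : (xs : List A) → xorSum (λ _ → false) xs ≡ false
xorSum-false []       = refl
xorSum-false (_ ∷ xs) = xorSum-false xs

xorSum-xor : ∀ (F G : A → Bool) xs → xorSum (λ x → F x xor G x) xs ≡ xorSum F xs xor xorSum G xs
xorSum-xor F G []       = refl
xorSum-xor F G (x ∷ xs) =
  trans (cong ((F x xor G x) xor_) (xorSum-xor F G xs)) (xor-interchange (F x) (G x) _ _)

xorSum-∧ˡ : ∀ c (F : A → Bool) xs → xorSum (λ x → c ∧ F x) xs ≡ c ∧ xorSum F xs
xorSum-∧ˡ false F xs = xorSum-false xs
xorSum-∧ˡ true  F xs = refl

xorSum-++ : ∀ (F : A → Bool) xs ys → xorSum F (xs ++ ys) ≡ xorSum F xs xor xorSum F ys
xorSum-++ F []       ys = refl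
xorSum-++ F (x ∷ xs) ys = trans (cong (F x xor_) (xorSum-++ F xs ys)) (sym (xor-assoc (F x) _ _))

xorSum-concatMap : ∀ (F : B → Bool) (G : A → List B) xs →
  xorSum F (concatMap G xs) ≡ xorSum (λ x → xorSum F (G x)) xs
xorSum-concatMap F G []       = refl
xorSum-concatMap F G (x ∷ xs) =
  trans (xorSum-++ F (G x) (concatMap G xs)) (cong (xorSum F (G x) xor_) (xorSum-concatMap F G xs))

xorSum-comm : ∀ (F : A → B → Bool) xs ys →
  xorSum (λ x → xorSum (F x) ys) xs ≡ xorSum (λ y → xorSum (λ x → F x y) xs) ys
xorSum-comm F []       ys = sym (xorSum-false ys)
xorSum-comm F (x ∷ xs) ys =
  trans (cong (xorSum (F x) ys xor_) (xorSum-comm F xs ys))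
        (sym (xorSum-xor (F x) (λ y → xorSum (λ x → F x y) xs) ys))

xorSum²-xor : ∀ (F G : A → B → Bool) xs ys →
  xorSum (λ x → xorSum (λ y → F x y xor G x y) ys) xs
    ≡ xorSum (λ x → xorSum (F x) ys) xs xor xorSum (λ x → xorSum (G x) ys) xs
xorSum²-xor F G xs ys =
  trans (xorSum-cong (λ x → xorSum-xor (F x) (G x) ys) xs) (xorSum-xor (λ x → xorSum (F x) ys) (λ x → xorSum (G x) ys) xs)

xorSum-tabulate : ∀ n (F : A → Bool) (g : Fin n → A) →
  xorSum F (tabulate g) ≡ xorSum (λ i → F (g i)) (allFin n)
xorSum-tabulate zero    F g = refl
xorSum-tabulate (suc n) F g = cong (F (g zero) xor_)
  (trans (xorSum-tabulate n F (λ i → g (suc i))) (sym (xorSum-tabulate n (λ i → F (g i)) suc)))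

xorSum-pairs : ∀ n (G : Fin n × Fin n → Bool) →
  xorSum G (pairs n) ≡ xorSum (λ i → xorSum (λ j → (toℕ i <ᵇ toℕ j) ∧ G (i , j)) (allFin n)) (allFin n)
xorSum-pairs n G =
  trans (xorSum-concatMap G _ (allFin n))
        (xorSum-cong (λ i → trans (xorSum-concatMap G _ (allFin n))
                                  (xorSum-cong (λ j → singleton (toℕ i <ᵇ toℕ j) (i , j)) (allFin n)))
                     (allFin n))
  where
  singleton : ∀ c p → xorSum G (if c then p ∷ [] else []) ≡ c ∧ G p
  singleton true  p = xor-identityʳ (G p)
  singleton false p = refl

<ᵇ-connex-∧ : ∀ (i j : Fin n) b → (i ≡ j → b ≡ false) → ((toℕ i <ᵇ toℕ j) xor (toℕ j <ᵇ toℕ i)) ∧ b ≡ b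
<ᵇ-connex-∧ zero    zero    b b≡false = sym (b≡false refl)
<ᵇ-connex-∧ zero    (suc j) b _       = refl
<ᵇ-connex-∧ (suc i) zero    b _       = refl
<ᵇ-connex-∧ (suc i) (suc j) b b≡false = <ᵇ-connex-∧ i j b (λ i≡j → b≡false (cong suc i≡j))

xorSum-pairs-symmetrise : ∀ n (H : Fin n → Fin n → Bool) → (∀ i → H i i ≡ false) →
  xorSum (λ p → H (proj₁ p) (proj₂ p) xor H (proj₂ p) (proj₁ p)) (pairs n)
    ≡ xorSum (λ i → xorSum (H i) (allFin n)) (allFin n)
xorSum-pairs-symmetrise n H H-diag = begin
  xorSum (λ p → H (proj₁ p) (proj₂ p) xor H (proj₂ p) (proj₁ p)) (pairs n)
    ≡⟨ xorSum-pairs n _ ⟩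
  Σ² (λ i j → (i < j) ∧ (H i j xor H j i))
    ≡⟨ xorSum-cong (λ i → xorSum-cong (λ j → ∧-distribˡ-xor (i < j) (H i j) (H j i)) all) all ⟩
  Σ² (λ i j → ((i < j) ∧ H i j) xor ((i < j) ∧ H j i))
    ≡⟨ xorSum²-xor (λ i j → (i < j) ∧ H i j) (λ i j → (i < j) ∧ H j i) all all ⟩
  Σ² (λ i j → (i < j) ∧ H i j) xor Σ² (λ i j → (i < j) ∧ H j i)
    ≡⟨ cong (Σ² (λ i j → (i < j) ∧ H i j) xor_) (xorSum-comm (λ i j → (i < j) ∧ H j i) all all) ⟩
  Σ² (λ i j → (i < j) ∧ H i j) xor Σ² (λ i j → (j < i) ∧ H i j)
    ≡⟨ sym (xorSum²-xor (λ i j → (i < j) ∧ H i j) (λ i j → (j < i) ∧ H i j) all all) ⟩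
  Σ² (λ i j → ((i < j) ∧ H i j) xor ((j < i) ∧ H i j))
    ≡⟨ xorSum-cong (λ i → xorSum-cong (λ j → both-orders i j) all) all ⟩
  Σ² H ∎
  where
  all : List (Fin n)
  all = allFin n
  _<_ : Fin n → Fin n → Bool
  i < j = toℕ i <ᵇ toℕ j
  Σ² : (Fin n → Fin n → Bool) → Bool
  Σ² K = xorSum (λ i → xorSum (K i) all) all
  both-orders : ∀ i j → ((i < j) ∧ H i j) xor ((j < i) ∧ H i j) ≡ H i j
  both-orders i j = trans (sym (∧-distribʳ-xor (H i j) (i < j) (j < i)))
                          (<ᵇ-connex-∧ i j (H i j) (λ { refl → H-diag i }))

-- Handshake lemma over F₂: every edge {i, j} of the symmetric graph E is counted at both ends.
xorSum-pairs-handshake : ∀ n (E : Fin n → Fin n → Bool) (u : Fin n → Bool) →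
  (∀ i j → E j i ≡ E i j) → (∀ i → E i i ≡ false) →
  xorSum (λ p → (E (proj₁ p) (proj₂ p) ∧ u (proj₁ p)) xor (E (proj₁ p) (proj₂ p) ∧ u (proj₂ p))) (pairs n)
    ≡ xorSum (λ i → u i ∧ xorSum (E i) (allFin n)) (allFin n)
xorSum-pairs-handshake n E u E-sym E-diag =
  trans (xorSum-cong (λ p → cong (λ e → (E (proj₁ p) (proj₂ p) ∧ u (proj₁ p)) xor (e ∧ u (proj₂ p)))
                                 (sym (E-sym (proj₁ p) (proj₂ p))))
                     (pairs n))
  (trans (xorSum-pairs-symmetrise n (λ i j → E i j ∧ u i) (λ i → cong (_∧ u i) (E-diag i)))
         (xorSum-cong (λ i → trans (xorSum-cong (λ j → ∧-comm (E i j) (u i)) (allFin n))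
                                   (xorSum-∧ˡ (u i) (E i) (allFin n)))
                      (allFin n)))

-- Parity of natural numbers and of degrees

odd : ℕ → Bool
odd zero    = false
odd (suc k) = not (odd k)

%2≡odd : ∀ k → k % 2 ≡ (if odd k then 1 else 0)
%2≡odd zero          = refl
%2≡odd (suc zero)    = refl
%2≡odd (suc (suc k)) = begin
  suc (suc k) % 2                      ≡⟨ cong (_% 2) (ℕ.+-comm 2 k) ⟩
  (k +ℕ 2) % 2                         ≡⟨ [m+n]%n≡m%n k 2 ⟩
  k % 2                                ≡⟨ %2≡odd k ⟩
  (if odd k then 1 else 0)             ≡⟨ cong (λ b → if b then 1 else 0) (sym (not-involutive (odd k))) ⟩
  (if not (not (odd k)) then 1 else 0) ∎

%2≡⇒odd≡ : ∀ a b → a % 2 ≡ b % 2 → odd a ≡ odd b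
%2≡⇒odd≡ a b e = indicator-injective (odd a) (odd b) (trans (sym (%2≡odd a)) (trans e (%2≡odd b)))
  where
  indicator-injective : ∀ x y → (if x then 1 else 0) ≡ (if y then 1 else 0) → x ≡ y
  indicator-injective true  true  _ = refl
  indicator-injective false false _ = refl
  indicator-injective true  false ()
  indicator-injective false true  ()

odd≡⇒%2≡ : ∀ a b → odd a ≡ odd b → a % 2 ≡ b % 2
odd≡⇒%2≡ a b e = trans (%2≡odd a) (trans (cong (λ x → if x then 1 else 0) e) (sym (%2≡odd b)))

odd-count : ∀ (F : A → Bool) xs → odd (sumℕ (λ x → if F x then 1 else 0) xs) ≡ xorSum F xs
odd-count F = foldr-fusion odd 0 (λ x k → step (F x) k)
  where
  step : ∀ b k → odd ((if b then 1 else 0) +ℕ k) ≡ b xor odd k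
  step true  k = refl
  step false k = refl

odd-+ : ∀ a b → odd (a +ℕ b) ≡ odd a xor odd b
odd-+ zero    b = refl
odd-+ (suc a) b = trans (cong not (odd-+ a b)) (not-distribˡ-xor (odd a) (odd b))

odd-∣∣ : (J : Subset n) → odd ∣ J ∣ ≡ xorSum (λ i → i ∈ᵇ J) (allFin n)
odd-∣∣ Vec.[]                   = refl
odd-∣∣ {suc n} (true  Vec.∷ J) =
  cong not (trans (odd-∣∣ J) (sym (xorSum-tabulate n (λ i → i ∈ᵇ (true Vec.∷ J)) suc)))
odd-∣∣ {suc n} (false Vec.∷ J) =
  trans (odd-∣∣ J) (sym (xorSum-tabulate n (λ i → i ∈ᵇ (false Vec.∷ J)) suc))

≢⇒xor≡true : ∀ {a b} → a ≢ b → a xor b ≡ true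
≢⇒xor≡true {true}  {true}  a≢b = contradiction refl a≢b
≢⇒xor≡true {true}  {false} _   = refl
≢⇒xor≡true {false} {true}  _   = refl
≢⇒xor≡true {false} {false} a≢b = contradiction refl a≢b

degParity : PSet n → Bool
degParity {n} S = xorSum (λ l → elt l ∈ᵇ S) (allFin n)

odd-deg : (S : PSet n) → odd (deg S) ≡ degParity S
odd-deg {n} S = foldr-fusion odd 0 (λ l k → step (elt l ∈ᵇ S) k) (allFin n)
  where
  step : ∀ b k → odd (if b then suc k else k) ≡ b xor odd k
  step true  k = refl
  step false k = refl

degParity-+ : (S T : PSet n) → degParity (S +ₛ T) ≡ degParity S xor degParity T
degParity-+ {n} S T =
  trans (xorSum-cong (λ l → lookup-zipWith _xor_ (elt l) S T) (allFin n))
        (xorSum-xor (λ l → elt l ∈ᵇ S) (λ l → elt l ∈ᵇ T) (allFin n))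

degParity-constant : ∀ b → degParity {n} (b Vec.∷ replicate n false) ≡ false
degParity-constant {n} b =
  trans (xorSum-cong (λ l → lookup-replicate l false) (allFin n)) (xorSum-false (allFin n))

degParity-minus-+ : ∀ (S T : PSet n) → degParity S ≡ degParity T → degParity (minusSet +ₛ (S +ₛ T)) ≡ false
degParity-minus-+ {n} S T e = begin
  degParity (minusSet {n} +ₛ (S +ₛ T))            ≡⟨ degParity-+ minusSet (S +ₛ T) ⟩
  degParity (minusSet {n}) xor degParity (S +ₛ T) ≡⟨ cong₂ _xor_ (degParity-constant {n} true) (degParity-+ S T) ⟩
  degParity S xor degParity T                     ≡⟨ cong (_xor degParity T) e ⟩
  degParity T xor degParity T                     ≡⟨ xor-same (degParity T) ⟩
  false                                           ∎

degParity-gvec : ∀ {m} (S₁ S₂ S₃ : Fin m → PSet n) i j →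
  (degParity (S₁ i) ≡ degParity (S₂ i)) × (degParity (S₂ i) ≡ degParity (S₃ i)) →
  degParity (gvec S₁ S₂ S₃ i j) ≡ false
degParity-gvec {n} S₁ S₂ S₃ i j (e₁₂ , e₂₃)
  with elt j ∈ᵇ S₁ i | elt j ∈ᵇ S₂ i | elt j ∈ᵇ S₃ i
... | true  | _     | _     = degParity-minus-+ (S₂ i) (S₃ i) e₂₃
... | false | true  | _     = degParity-minus-+ (S₁ i) (S₃ i) (trans e₁₂ e₂₃)
... | false | false | true  = degParity-minus-+ (S₁ i) (S₂ i) e₁₂
... | false | false | false = degParity-constant {n} false

degParity-linComb : ∀ {m} (g : Fin m → PSet n) → (∀ i → degParity (g i) ≡ false) →
  ∀ c → degParity (linComb c g) ≡ false
degParity-linComb {n} {m} g g-even c = go (allFin m)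
  where
  go : ∀ is → degParity (foldr (λ i acc → if c i then g i +ₛ acc else acc) ∅ₛ is) ≡ false
  go []       = degParity-constant {n} false
  go (i ∷ is) with c i
  ... | true  = trans (degParity-+ (g i) _) (cong₂ _xor_ (g-even i) (go is))
  ... | false = go is

InV⇒degParity≡false : ∀ {m} (S₁ S₂ S₃ : Fin m → PSet n) →
  (∀ i → (degParity (S₁ i) ≡ degParity (S₂ i)) × (degParity (S₂ i) ≡ degParity (S₃ i))) →
  ∀ j {T} → InV S₁ S₂ S₃ j T → degParity T ≡ false
InV⇒degParity≡false S₁ S₂ S₃ equal-parity j (c , refl) =
  degParity-linComb (λ i → gvec S₁ S₂ S₃ i j) (λ i → degParity-gvec S₁ S₂ S₃ i j (equal-parity i)) c

deg%2≡⇒degParity≡ : ∀ (S T : PSet n) → deg S % 2 ≡ deg T % 2 → degParity S ≡ degParity T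
deg%2≡⇒degParity≡ S T e = trans (sym (odd-deg S)) (trans (%2≡⇒odd≡ (deg S) (deg T) e) (odd-deg T))

twParity : (Fin n → PSet n) → Bool
twParity {n} f =
  xorSum (λ i → minusIdx ∈ᵇ f i) (allFin n) xor xorSum (λ p → elt (proj₂ p) ∈ᵇ f (proj₁ p)) (pairs n)

odd-twExponent : (f : Fin n → PSet n) → odd (twExponent f) ≡ twParity f
odd-twExponent {n} f =
  trans (odd-+ (sumℕ (λ i → if minusIdx ∈ᵇ f i then 1 else 0) (allFin n)) _)
        (cong₂ _xor_ (odd-count (λ i → minusIdx ∈ᵇ f i) (allFin n))
                     (odd-count (λ p → elt (proj₂ p) ∈ᵇ f (proj₁ p)) (pairs n)))

-- Negating all signs

flipSigns : Vec Sign n → Vec Sign n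
flipSigns = Vec.map opposite

flipIf : Bool → Sign → Sign
flipIf true  σ = opposite σ
flipIf false σ = σ

evalMonoOn : List (Fin n) → PSet n → Vec Sign n → Sign
evalMonoOn xs S s =
  foldr (λ l acc → (if elt l ∈ᵇ S then lookup s l else Sign.+) Sign.* acc)
        (if minusIdx ∈ᵇ S then Sign.- else Sign.+) xs

evalMonoOn-flipSigns : ∀ xs (S : PSet n) s →
  evalMonoOn xs S (flipSigns s) ≡ flipIf (xorSum (λ l → elt l ∈ᵇ S) xs) (evalMonoOn xs S s)
evalMonoOn-flipSigns []       S s = refl
evalMonoOn-flipSigns (l ∷ xs) S s with elt l ∈ᵇ S
... | false = evalMonoOn-flipSigns xs S s
... | true  = trans (cong₂ Sign._*_ (lookup-map l opposite s) (evalMonoOn-flipSigns xs S s))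
                    (opposite-*-flipIf (lookup s l) (xorSum (λ l → elt l ∈ᵇ S) xs) (evalMonoOn xs S s))
  where
  opposite-*-flipIf : ∀ σ b τ → opposite σ Sign.* flipIf b τ ≡ flipIf (not b) (σ Sign.* τ)
  opposite-*-flipIf Sign.+ true  τ = opposite-involutive τ
  opposite-*-flipIf Sign.+ false τ = refl
  opposite-*-flipIf Sign.- true  τ = refl
  opposite-*-flipIf Sign.- false τ = sym (opposite-involutive τ)

evalMono-flipSigns : ∀ (S : PSet n) s → evalMono S (flipSigns s) ≡ flipIf (degParity S) (evalMono S s)
evalMono-flipSigns {n} = evalMonoOn-flipSigns (allFin n)

conicRealSolvable-flipIf : ∀ b x y z →
  conicRealSolvable (flipIf b x) (flipIf b y) (flipIf b z) ≡ conicRealSolvable x y z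
conicRealSolvable-flipIf false x      y      z      = refl
conicRealSolvable-flipIf true  Sign.+ Sign.+ Sign.+ = refl
conicRealSolvable-flipIf true  Sign.+ Sign.+ Sign.- = refl
conicRealSolvable-flipIf true  Sign.+ Sign.- Sign.+ = refl
conicRealSolvable-flipIf true  Sign.+ Sign.- Sign.- = refl
conicRealSolvable-flipIf true  Sign.- Sign.+ Sign.+ = refl
conicRealSolvable-flipIf true  Sign.- Sign.+ Sign.- = refl
conicRealSolvable-flipIf true  Sign.- Sign.- Sign.+ = refl
conicRealSolvable-flipIf true  Sign.- Sign.- Sign.- = refl

admissible-flipSigns : ∀ {m} (S₁ S₂ S₃ : Fin m → PSet n) →
  (∀ i → (degParity (S₁ i) ≡ degParity (S₂ i)) × (degParity (S₂ i) ≡ degParity (S₃ i))) →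
  ∀ s → admissible S₁ S₂ S₃ (flipSigns s) ≡ admissible S₁ S₂ S₃ s
admissible-flipSigns {m = m} S₁ S₂ S₃ equal-parity s =
  foldr-cong (λ i acc → cong (_∧ acc) (conic-flipSigns i)) refl (allFin m)
  where
  conic-flipSigns : ∀ i →
    conicRealSolvable (evalMono (S₁ i) (flipSigns s)) (evalMono (S₂ i) (flipSigns s)) (evalMono (S₃ i) (flipSigns s))
      ≡ conicRealSolvable (evalMono (S₁ i) s) (evalMono (S₂ i) s) (evalMono (S₃ i) s)
  conic-flipSigns i
    rewrite evalMono-flipSigns (S₁ i) s | evalMono-flipSigns (S₂ i) s | evalMono-flipSigns (S₃ i) s
          | proj₁ (equal-parity i) | proj₂ (equal-parity i)
    = conicRealSolvable-flipIf (degParity (S₃ i)) _ _ _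

sumℤ-cong : {F G : A → ℤ} → (∀ x → F x ≡ G x) → ∀ xs → sumℤ F xs ≡ sumℤ G xs
sumℤ-cong F≗G = foldr-cong (λ x acc → cong (_+ℤ acc) (F≗G x)) refl

sumℤ-neg : ∀ (F : A → ℤ) xs → sumℤ (λ x → - F x) xs ≡ - sumℤ F xs
sumℤ-neg F xs = sym (foldr-fusion -_ 0ℤ (λ x k → neg-distrib-+ (F x) k) xs)

sumℤ-concatMap-pair : ∀ (h : B → ℤ) (a b : A → B) xs →
  sumℤ h (concatMap (λ x → a x ∷ b x ∷ []) xs) ≡ sumℤ (λ x → h (a x) +ℤ h (b x)) xs
sumℤ-concatMap-pair h a b []       = refl
sumℤ-concatMap-pair h a b (x ∷ xs) =
  trans (cong (λ t → h (a x) +ℤ (h (b x) +ℤ t)) (sumℤ-concatMap-pair h a b xs))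
        (sym (+-assoc (h (a x)) (h (b x)) _))

sumℤ-allSigns-flipSigns : ∀ n (h : Vec Sign n → ℤ) →
  sumℤ (λ s → h (flipSigns s)) (allSigns n) ≡ sumℤ h (allSigns n)
sumℤ-allSigns-flipSigns zero    h = refl
sumℤ-allSigns-flipSigns (suc n) h = begin
  sumℤ (λ s → h (flipSigns s)) (allSigns (suc n))
    ≡⟨ sumℤ-concatMap-pair (λ s → h (flipSigns s)) (Sign.+ Vec.∷_) (Sign.- Vec.∷_) (allSigns n) ⟩
  sumℤ (λ v → h (Sign.- Vec.∷ flipSigns v) +ℤ h (Sign.+ Vec.∷ flipSigns v)) (allSigns n)
    ≡⟨ sumℤ-cong (λ v → +-comm (h (Sign.- Vec.∷ flipSigns v)) _) (allSigns n) ⟩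
  sumℤ (λ v → h (Sign.+ Vec.∷ flipSigns v) +ℤ h (Sign.- Vec.∷ flipSigns v)) (allSigns n)
    ≡⟨ sumℤ-allSigns-flipSigns n (λ v → h (Sign.+ Vec.∷ v) +ℤ h (Sign.- Vec.∷ v)) ⟩
  sumℤ (λ v → h (Sign.+ Vec.∷ v) +ℤ h (Sign.- Vec.∷ v)) (allSigns n)
    ≡⟨ sym (sumℤ-concatMap-pair h (Sign.+ Vec.∷_) (Sign.- Vec.∷_) (allSigns n)) ⟩
  sumℤ h (allSigns (suc n)) ∎

sumℤ-allSigns-antisymmetric : ∀ n (h : Vec Sign n → ℤ) → (∀ s → h (flipSigns s) ≡ - h s) →
  sumℤ h (allSigns n) ≡ 0ℤ
sumℤ-allSigns-antisymmetric n h h-flip = i≡-i⇒i≡0 (begin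
  sumℤ h (allSigns n)                       ≡⟨ sym (sumℤ-allSigns-flipSigns n h) ⟩
  sumℤ (λ s → h (flipSigns s)) (allSigns n) ≡⟨ sumℤ-cong h-flip (allSigns n) ⟩
  sumℤ (λ s → - h s) (allSigns n)           ≡⟨ sumℤ-neg h (allSigns n) ⟩
  - sumℤ h (allSigns n)                     ∎)
  where
  i≡-i⇒i≡0 : ∀ {i} → i ≡ - i → i ≡ 0ℤ
  i≡-i⇒i≡0 {+ zero}    _  = refl
  i≡-i⇒i≡0 {+ suc _}   ()
  i≡-i⇒i≡0 {ℤ.-[1+ _ ]} ()

-- The summand as a power of -1

-1^_ : Bool → ℤ
-1^ true  = -1ℤ
-1^ false = 1ℤ

-1^-xor : ∀ a b → -1^ (a xor b) ≡ -1^ a * -1^ b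
-1^-xor true  true  = refl
-1^-xor true  false = refl
-1^-xor false true  = refl
-1^-xor false false = refl

-1^-not : ∀ a → -1^ (not a) ≡ - -1^ a
-1^-not true  = refl
-1^-not false = refl

-1^-if : ∀ b {z} e → z ≡ -1^ e → (if b then z else 1ℤ) ≡ -1^ (b ∧ e)
-1^-if true  e z≡ = z≡
-1^-if false e _  = refl

prodℤ≡-1^xorSum : ∀ {h : A → ℤ} (F : A → Bool) → (∀ x → h x ≡ -1^ F x) → ∀ xs → prodℤ h xs ≡ -1^ xorSum F xs
prodℤ≡-1^xorSum {h = h} F h≡ xs =
  sym (foldr-fusion -1^_ false (λ x k → trans (-1^-xor (F x) k) (cong (_* -1^ k) (sym (h≡ x)))) xs)

isNeg : Sign → Bool
isNeg Sign.- = true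
isNeg Sign.+ = false

hilbert2-minusOne-sign : ∀ σ → hilbert2 -1ℚ (signℚ σ) ≡ -1^ isNeg σ
hilbert2-minusOne-sign Sign.- = refl
hilbert2-minusOne-sign Sign.+ = refl

hilbert2-signs : ∀ σ τ → hilbert2 (signℚ σ) (signℚ τ) ≡ -1^ (isNeg σ ∧ isNeg τ)
hilbert2-signs Sign.- Sign.- = refl
hilbert2-signs Sign.- Sign.+ = refl
hilbert2-signs Sign.+ Sign.- = refl
hilbert2-signs Sign.+ Sign.+ = refl

kron-1-sign : ∀ σ → kron-1 σ ≡ -1^ isNeg σ
kron-1-sign Sign.- = refl
kron-1-sign Sign.+ = refl

linForm : (Fin n → Bool) → (Fin n → Bool) → Bool
linForm {n} c u = xorSum (λ i → c i ∧ u i) (allFin n)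

quadForm : (Fin n → Fin n → Bool) → (Fin n → Bool) → Bool
quadForm {n} E u = xorSum (λ p → E (proj₁ p) (proj₂ p) ∧ (u (proj₁ p) ∧ u (proj₂ p))) (pairs n)

linForm-complement : ∀ (c u v : Fin n → Bool) → (∀ i → v i ≡ not (u i)) →
  linForm c v ≡ linForm c u xor xorSum c (allFin n)
linForm-complement {n} c u v v≡¬u =
  trans (xorSum-cong (λ i → trans (cong (c i ∧_) (v≡¬u i)) (expand (c i) (u i))) (allFin n))
        (xorSum-xor (λ i → c i ∧ u i) c (allFin n))
  where
  expand : ∀ a x → a ∧ not x ≡ (a ∧ x) xor a
  expand true  true  = refl
  expand true  false = refl
  expand false x     = refl

quadForm-complement : ∀ (E : Fin n → Fin n → Bool) (u v : Fin n → Bool) →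
  (∀ i j → E j i ≡ E i j) → (∀ i → E i i ≡ false) → (∀ i → xorSum (E i) (allFin n) ≡ false) →
  (∀ i → v i ≡ not (u i)) →
  quadForm E v ≡ quadForm E u xor xorSum (λ p → E (proj₁ p) (proj₂ p)) (pairs n)
quadForm-complement {n} E u v E-sym E-diag E-rows v≡¬u = begin
  quadForm E v
    ≡⟨ xorSum-cong (λ p → trans (cong₂ (λ x y → e p ∧ (x ∧ y)) (v≡¬u (proj₁ p)) (v≡¬u (proj₂ p)))
                                (expand (e p) (u (proj₁ p)) (u (proj₂ p)))) (pairs n) ⟩
  xorSum (λ p → q p xor (e p xor cross p)) (pairs n)
    ≡⟨ xorSum-xor q (λ p → e p xor cross p) (pairs n) ⟩
  quadForm E u xor xorSum (λ p → e p xor cross p) (pairs n)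
    ≡⟨ cong (quadForm E u xor_) (xorSum-xor e cross (pairs n)) ⟩
  quadForm E u xor (xorSum e (pairs n) xor xorSum cross (pairs n))
    ≡⟨ cong (λ t → quadForm E u xor (xorSum e (pairs n) xor t)) cross-vanishes ⟩
  quadForm E u xor (xorSum e (pairs n) xor false)
    ≡⟨ cong (quadForm E u xor_) (xor-identityʳ _) ⟩
  quadForm E u xor xorSum e (pairs n) ∎
  where
  e q cross : Fin n × Fin n → Bool
  e p     = E (proj₁ p) (proj₂ p)
  q p     = e p ∧ (u (proj₁ p) ∧ u (proj₂ p))
  cross p = (e p ∧ u (proj₁ p)) xor (e p ∧ u (proj₂ p))
  expand : ∀ a x y → a ∧ (not x ∧ not y) ≡ (a ∧ (x ∧ y)) xor (a xor ((a ∧ x) xor (a ∧ y)))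
  expand true  true  true  = refl
  expand true  true  false = refl
  expand true  false true  = refl
  expand true  false false = refl
  expand false x     y     = refl
  cross-vanishes : xorSum cross (pairs n) ≡ false
  cross-vanishes = begin
    xorSum cross (pairs n)
      ≡⟨ xorSum-pairs-handshake n E u E-sym E-diag ⟩
    xorSum (λ i → u i ∧ xorSum (E i) (allFin n)) (allFin n)
      ≡⟨ xorSum-cong (λ i → trans (cong (u i ∧_) (E-rows i)) (∧-zeroʳ (u i))) (allFin n) ⟩
    xorSum (λ _ → false) (allFin n)
      ≡⟨ xorSum-false (allFin n) ⟩
    false ∎

negatives : Vec Sign n → Fin n → Bool
negatives s i = isNeg (lookup s i)

negatives-flipSigns : ∀ (s : Vec Sign n) i → negatives (flipSigns s) i ≡ not (negatives s i)
negatives-flipSigns s i = trans (cong isNeg (lookup-map i opposite s)) (isNeg-opposite (lookup s i))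
  where
  isNeg-opposite : ∀ σ → isNeg (opposite σ) ≡ not (isNeg σ)
  isNeg-opposite Sign.- = refl
  isNeg-opposite Sign.+ = refl

twistedSummand : (f : Fin n → PSet n) → Subset n → Vec Sign n → ℤ
twistedSummand {n} f J s =
  Tw f (λ i → signℚ (lookup s i)) * prodℤ (λ i → if i ∈ᵇ J then kron-1 (lookup s i) else + 1) (allFin n)

summandExponent : (f : Fin n → PSet n) → Subset n → (Fin n → Bool) → Bool
summandExponent f J u =
  (linForm (λ i → minusIdx ∈ᵇ f i) u xor quadForm (λ i j → elt j ∈ᵇ f i) u) xor linForm (λ i → i ∈ᵇ J) u

twistedSummand≡-1^ : ∀ (f : Fin n → PSet n) J s → twistedSummand f J s ≡ -1^ summandExponent f J (negatives s)
twistedSummand≡-1^ {n} f J s = begin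
  twistedSummand f J s
    ≡⟨ cong₂ _*_ (cong₂ _*_ twist-linear twist-quadratic) kronecker ⟩
  (-1^ linear⁻ * -1^ quadratic) * -1^ linearJ
    ≡⟨ cong (_* -1^ linearJ) (sym (-1^-xor linear⁻ quadratic)) ⟩
  -1^ (linear⁻ xor quadratic) * -1^ linearJ
    ≡⟨ sym (-1^-xor (linear⁻ xor quadratic) linearJ) ⟩
  -1^ summandExponent f J (negatives s) ∎
  where
  u : Fin n → Bool
  u = negatives s
  linear⁻ quadratic linearJ : Bool
  linear⁻ = linForm (λ i → minusIdx ∈ᵇ f i) u
  quadratic = quadForm (λ i j → elt j ∈ᵇ f i) u
  linearJ = linForm (λ i → i ∈ᵇ J) u
  twist-linear : prodℤ (λ i → if minusIdx ∈ᵇ f i then hilbert2 -1ℚ (signℚ (lookup s i)) else + 1) (allFin n)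
                   ≡ -1^ linear⁻
  twist-linear = prodℤ≡-1^xorSum _ (λ i → -1^-if (minusIdx ∈ᵇ f i) _ (hilbert2-minusOne-sign (lookup s i))) (allFin n)
  twist-quadratic : prodℤ (λ p → if elt (proj₂ p) ∈ᵇ f (proj₁ p)
                                 then hilbert2 (signℚ (lookup s (proj₁ p))) (signℚ (lookup s (proj₂ p)))
                                 else + 1) (pairs n)
                      ≡ -1^ quadratic
  twist-quadratic = prodℤ≡-1^xorSum _ (λ p → -1^-if (elt (proj₂ p) ∈ᵇ f (proj₁ p)) _
                                        (hilbert2-signs (lookup s (proj₁ p)) (lookup s (proj₂ p)))) (pairs n)
  kronecker : prodℤ (λ i → if i ∈ᵇ J then kron-1 (lookup s i) else + 1) (allFin n) ≡ -1^ linearJ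
  kronecker = prodℤ≡-1^xorSum _ (λ i → -1^-if (i ∈ᵇ J) _ (kron-1-sign (lookup s i))) (allFin n)

summandExponent-complement : ∀ (f : Fin n → PSet n) J (u v : Fin n → Bool) →
  (∀ i j → elt i ∈ᵇ f j ≡ elt j ∈ᵇ f i) → (∀ j → elt j ∈ᵇ f j ≡ false) → (∀ j → degParity (f j) ≡ false) →
  twParity f xor xorSum (λ i → i ∈ᵇ J) (allFin n) ≡ true →
  (∀ i → v i ≡ not (u i)) →
  summandExponent f J v ≡ not (summandExponent f J u)
summandExponent-complement {n} f J u v f-sym f-diag f-even odd-total v≡¬u = begin
  summandExponent f J v
    ≡⟨ cong₂ _xor_ (cong₂ _xor_ (linForm-complement (λ i → minusIdx ∈ᵇ f i) u v v≡¬u)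
                                (quadForm-complement (λ i j → elt j ∈ᵇ f i) u v f-sym f-diag f-even v≡¬u))
                   (linForm-complement (λ i → i ∈ᵇ J) u v v≡¬u) ⟩
  ((ℓ⁻ xor c⁻) xor (q xor c₂)) xor (ℓJ xor cJ)
    ≡⟨ regroup ℓ⁻ q ℓJ c⁻ c₂ cJ ⟩
  summandExponent f J u xor ((c⁻ xor c₂) xor cJ)
    ≡⟨ cong (summandExponent f J u xor_) odd-total ⟩
  summandExponent f J u xor true
    ≡⟨ trans (xor-comm _ true) (true-xor _) ⟩
  not (summandExponent f J u) ∎
  where
  open xor-∧-Solver
  ℓ⁻ q ℓJ c⁻ c₂ cJ : Bool
  ℓ⁻ = linForm (λ i → minusIdx ∈ᵇ f i) u
  q  = quadForm (λ i j → elt j ∈ᵇ f i) u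
  ℓJ = linForm (λ i → i ∈ᵇ J) u
  c⁻ = xorSum (λ i → minusIdx ∈ᵇ f i) (allFin n)
  c₂ = xorSum (λ p → elt (proj₂ p) ∈ᵇ f (proj₁ p)) (pairs n)
  cJ = xorSum (λ i → i ∈ᵇ J) (allFin n)
  regroup : ∀ a b c x y z → ((a xor x) xor (b xor y)) xor (c xor z) ≡ ((a xor b) xor c) xor ((x xor y) xor z)
  regroup = solve 6 (λ a b c x y z → ((a :+ x) :+ (b :+ y)) :+ (c :+ z) := ((a :+ b) :+ c) :+ ((x :+ y) :+ z)) refl

twistedSummand-flipSigns : ∀ (f : Fin n → PSet n) J →
  (∀ i j → elt i ∈ᵇ f j ≡ elt j ∈ᵇ f i) → (∀ j → elt j ∈ᵇ f j ≡ false) → (∀ j → degParity (f j) ≡ false) →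
  twParity f xor xorSum (λ i → i ∈ᵇ J) (allFin n) ≡ true →
  ∀ s → twistedSummand f J (flipSigns s) ≡ - twistedSummand f J s
twistedSummand-flipSigns f J f-sym f-diag f-even odd-total s = begin
  twistedSummand f J (flipSigns s)
    ≡⟨ twistedSummand≡-1^ f J (flipSigns s) ⟩
  -1^ summandExponent f J (negatives (flipSigns s))
    ≡⟨ cong -1^_ (summandExponent-complement f J (negatives s) (negatives (flipSigns s))
                    f-sym f-diag f-even odd-total (negatives-flipSigns s)) ⟩
  -1^ not (summandExponent f J (negatives s))
    ≡⟨ -1^-not _ ⟩
  - -1^ summandExponent f J (negatives s)
    ≡⟨ cong -_ (sym (twistedSummand≡-1^ f J s)) ⟩
  - twistedSummand f J s ∎

if-else-0-neg : ∀ {a b : Bool} {x y : ℤ} → a ≡ b → x ≡ - y → (if a then x else 0ℤ) ≡ - (if b then y else 0ℤ)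
if-else-0-neg {b = true}  refl x≡-y = x≡-y
if-else-0-neg {b = false} refl _    = refl

lemma4p9 : (n m : ℕ) → 2 ≤ n → 1 ≤ m →
    (S₁ S₂ S₃ : Fin m → PSet n) →
    (∀ i → Coprime (S₁ i) (S₂ i) × Coprime (S₁ i) (S₃ i) × Coprime (S₂ i) (S₃ i)) →
    (∀ i → (deg (S₁ i) % 2 ≡ deg (S₂ i) % 2) × (deg (S₂ i) % 2 ≡ deg (S₃ i) % 2)) →
    (f : Fin n → PSet n) →
    (∀ j → InW S₁ S₂ S₃ j (f j)) →
    (∀ j → elt j ∈ᵇ f j ≡ false) →
    (∀ i j → elt i ∈ᵇ f j ≡ elt j ∈ᵇ f i) →
    (J : Subset n) →
    (∀ i → i ∈ᵇ J ≡ true → InV S₁ S₂ S₃ i minusSet) →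
    ∣ J ∣ % 2 ≢ twExponent f % 2 →
    twistedSum S₁ S₂ S₃ f J ≡ + 0
lemma4p9 n m _ _ S₁ S₂ S₃ _ deg-parity f f∈W f-diag f-sym J _ J-parity =
  sumℤ-allSigns-antisymmetric n (λ s → if admissible S₁ S₂ S₃ s then twistedSummand f J s else 0ℤ)
    (λ s → if-else-0-neg (admissible-flipSigns S₁ S₂ S₃ equal-parity s)
                         (twistedSummand-flipSigns f J f-sym f-diag f-even odd-total s))
  where
  equal-parity : ∀ i → (degParity (S₁ i) ≡ degParity (S₂ i)) × (degParity (S₂ i) ≡ degParity (S₃ i))
  equal-parity i = deg%2≡⇒degParity≡ (S₁ i) (S₂ i) (proj₁ (deg-parity i))
                 , deg%2≡⇒degParity≡ (S₂ i) (S₃ i) (proj₂ (deg-parity i))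
  f-even : ∀ j → degParity (f j) ≡ false
  f-even j = InV⇒degParity≡false S₁ S₂ S₃ equal-parity j (proj₁ (f∈W j))
  odd-total : twParity f xor xorSum (λ i → i ∈ᵇ J) (allFin n) ≡ true
  odd-total = ≢⇒xor≡true λ e →
    J-parity (odd≡⇒%2≡ ∣ J ∣ (twExponent f) (trans (odd-∣∣ J) (trans (sym e) (sym (odd-twExponent f)))))
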